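{- Let $S$ be a poset, let $(G_i)_{i\in S}$ be a family of impartial games, and let $G = S \odot_i G_i$ be their ordered join. Then: (1) $G$ is terminating if and only if the support of $G$ is a well partially ordered set and each component $G_i$ is terminating; (2) $G$ is short if and only if the support of $G$ is finite and each component $G_i$ is short.
   Context: All games are impartial combinatorial games under normal play; a game is determined by its set of options (games reachable by a single move), $G \to G'$ means $G'$ is an option of $G$, and $\mathbf{0}$ denotes the empty game (no options). A game is terminating if it admits no infinite sequence of moves, and short if it is terminating and has only finitely many positions. Ordered join: for a poset $S$ and a family of games $(G_i)_{i\in S}$, the ordered join $S \odot_i G_i$ is the game whose options are exactly the ordered joins $S \odot_i G'_i$ such that for one index $i_0\in S$ we have $G_{i_0}\to G'_{i_0}$, $G'_i=\mathbf{0}$ for all $i>i_0$, and $G'_i=G_i$ for all other $i$. (I.e., a move is made in one component, and all components strictly above it are discarded.) The support of $S\odot_i G_i$ is the induced subposet of $S$ consisting of all $i$ with $G_i\neq\mathbf{0}$. A poset is a well partially ordered set (wposet) if every infinite sequence in it contains an infinite ascending subsequence (equivalently, it has no infinite strictly descending chain and no infinite antichain). -}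

module Defs where

open import Level using (0ℓ)
open import Data.Nat using (ℕ; zero; suc) renaming (_≤_ to _≤ℕ_; _<_ to _<ℕ_)
open import Data.Fin using (Fin)
open import Data.Unit using (⊤; tt)
open import Data.Empty using (⊥)
open import Data.Sum using (_⊎_; inj₁; inj₂)
open import Data.Product using (Σ; _×_; _,_)
open import Relation.Nullary using (¬_)
open import Relation.Binary.PropositionalEquality using (_≡_; _≢_)

-- Impartial games (possibly non-terminating), presented as pointed
-- game graphs: a type of positions, a move relation and a starting
-- position.  Since a game is determined by its set of
-- options, two games are *equal* iff they are bisimilar (_≈_ below).

record Game : Set₁ where
  field
    Pos   : Set
    _⇒_   : Pos → Pos → Set
    start : Pos
open Game public

at : (G : Game) → Pos G → Game
at G p = record { Pos = Pos G ; _⇒_ = _⇒_ G ; start = p }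

_⟶_ : Game → Game → Set₁
G ⟶ G' = Σ (Pos G) λ p → _⇒_ G (start G) p × at G p ≡ G'

𝟘 : Game
𝟘 = record { Pos = ⊤ ; _⇒_ = λ _ _ → ⊥ ; start = tt }

_≈_ : Game → Game → Set₁
G ≈ H = Σ (Pos G → Pos H → Set) λ R →
  R (start G) (start H) ×
  ((p : Pos G) (q : Pos H) → R p q →
     ((p' : Pos G) → _⇒_ G p p' → Σ (Pos H) λ q' → _⇒_ H q q' × R p' q') ×
     ((q' : Pos H) → _⇒_ H q q' → Σ (Pos G) λ p' → _⇒_ G p p' × R p' q'))

data Reachable (G : Game) : Pos G → Set where
  here  : Reachable G (start G)
  there : ∀ {p q} → Reachable G p → _⇒_ G p q → Reachable G q

Terminating : Game → Set
Terminating G =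
  ¬ (Σ (ℕ → Pos G) λ s → (s zero ≡ start G) × ((n : ℕ) → _⇒_ G (s n) (s (suc n))))

-- G has finitely many positions (positions counted as games, i.e. up
-- to equality of games).
FinitelyManyPositions : Game → Set₁
FinitelyManyPositions G =
  Σ ℕ λ n → Σ (Fin n → Game) λ ps →
    (p : Pos G) → Reachable G p → Σ (Fin n) λ k → at G p ≈ ps k

Short : Game → Set₁
Short G = Terminating G × FinitelyManyPositions G

module OrderedJoin {S : Set} (_≤_ : S → S → Set) (G : S → Game) where

  -- state of component i: a position of G_i, or the empty game 0
  State : S → Set
  State i = Pos (G i) ⊎ ⊤

  StMove : (i : S) → State i → State i → Set
  StMove i (inj₁ p) (inj₁ q) = _⇒_ (G i) p q
  StMove i _        _        = ⊥

  JPos : Set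
  JPos = (i : S) → State i

  JMove : JPos → JPos → Set
  JMove F F' = Σ S λ i₀ →
    StMove i₀ (F i₀) (F' i₀) ×
    ((i : S) → i₀ ≤ i → i₀ ≢ i → F' i ≡ inj₂ tt) ×
    ((i : S) → ¬ (i₀ ≤ i) → F' i ≡ F i)

  join : Game
  join = record { Pos = JPos ; _⇒_ = JMove ; start = λ i → inj₁ (start (G i)) }

  -- the support of S ⊙_i G_i : the indices i with G_i ≠ 0
  -- (as a predicate on S; the induced subposet carries the restriction of _≤_)
  InSupport : S → Set₁
  InSupport i = ¬ (G i ≈ 𝟘)

IsWPO : {S : Set} (_≤_ : S → S → Set) (P : S → Set₁) → Set₁
IsWPO {S} _≤_ P =
  (f : ℕ → S) → ((n : ℕ) → P (f n)) →
  Σ (ℕ → ℕ) λ φ →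
    ((m n : ℕ) → m <ℕ n → φ m <ℕ φ n) ×
    ((m n : ℕ) → m ≤ℕ n → f (φ m) ≤ f (φ n))

FiniteSubset : {S : Set} (P : S → Set₁) → Set₁
FiniteSubset {S} P =
  Σ ℕ λ n → Σ (Fin n → S) λ e → (i : S) → P i → Σ (Fin n) λ k → e k ≡ i

{-# OPTIONS --safe #-}
module Submission where

-- (1) If the support contains a bad sequence i₀, i₁, … (no iₘ ≤ iₙ for m < n), the components
-- can be opened in that order, no move zeroing a later one: an infinite play. Conversely,
-- along an infinite play the wpo property yields an ascending subsequence of moved
-- components; they all coincide, since a move in a component zeroes everything strictly
-- above it for good, so that one component has an infinite play.
-- (2) An infinite support contains an ascending sequence of distinct indices; two of their
-- one-move openings i < j lie in the same cover class, yet from the opening of j one moves to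
-- the opening of i, so a reachable position simulates one of its options, contradicting
-- termination. Each G i embeds into the join, reflecting bisimilarity, once the components
-- incomparable with i are played out. Conversely, a reachable position of the join is
-- determined up to bisimilarity by the cover classes of its finitely many live components.

open import Defs
import Level
open import Level using (0ℓ; lift; lower)
open import Data.Nat using (ℕ; zero; suc; _+_; _∸_; _^_; z≤n; s≤s) renaming (_≤_ to _≤ℕ_; _<_ to _<ℕ_)
import Data.Nat.Properties as ℕ
open import Data.Fin using (Fin; toℕ; punchOut; inject≤; funToFin; finToFun)
import Data.Fin as Fin
import Data.Fin.Properties as Finₚ
open import Data.Product using (_×_; Σ; _,_; proj₁; proj₂)
open import Data.Sum using (_⊎_; inj₁; inj₂)
open import Data.Empty using (⊥; ⊥-elim)
open import Data.Unit using (⊤; tt)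
open import Function using (flip; _∘_; id)
open import Function.Bundles using (_⇔_; mk⇔)
open import Relation.Nullary using (¬_; Dec; yes; no)
open import Relation.Nullary.Decidable using (map′; decidable-stable)
open import Relation.Binary.PropositionalEquality using (_≡_; refl; sym; trans; cong; cong-app; subst; subst₂; _≢_)
open import Relation.Binary.Structures using (IsPartialOrder)
open import Axiom.ExcludedMiddle using (ExcludedMiddle)

Run : {X : Set} → (X → X → Set) → X → Set
Run {X} R x = Σ (ℕ → X) λ s → s zero ≡ x × ((n : ℕ) → R (s n) (s (suc n)))

module _ {X : Set} {R : X → X → Set} where

  Run-cons : ∀ {x y} → R x y → Run R y → Run R x
  Run-cons {x} x→y (s , s₀ , steps) = cons , refl , cons-steps
    where
    cons : ℕ → X
    cons zero    = x
    cons (suc n) = s n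
    cons-steps : (n : ℕ) → R (cons n) (cons (suc n))
    cons-steps zero    = subst (R x) (sym s₀) x→y
    cons-steps (suc n) = steps n

  Run-uncons : ∀ {x} → Run R x → Σ X λ y → R x y × Run R y
  Run-uncons (s , refl , steps) = s 1 , steps 0 , (s ∘ suc) , refl , steps ∘ suc

  Run-transport : ∀ {x y} → (∀ {z} → R x z → R y z) → Run R x → Run R y
  Run-transport x⊆y run with Run-uncons run
  ... | z , x→z , rest = Run-cons (x⊆y x→z) rest

Run-map : {X Y : Set} {R : X → X → Set} {R′ : Y → Y → Set} (h : X → Y) →
          (∀ {x y} → R x y → R′ (h x) (h y)) → ∀ {x} → Run R x → Run R′ (h x)
Run-map h h-mono (s , refl , steps) = h ∘ s , refl , h-mono ∘ steps

reachable-Run⇒¬Terminating : (G : Game) {p : Pos G} → Reachable G p → Run (_⇒_ G) p → ¬ Terminating G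
reachable-Run⇒¬Terminating G here        run term = term run
reachable-Run⇒¬Terminating G (there r m) run term = reachable-Run⇒¬Terminating G r (Run-cons m run) term

module _ {A B : Set} (RA : A → A → Set) (RB : B → B → Set) where

  Simulation : (A → B → Set) → Set
  Simulation Q = (p : A) (q : B) → Q p q → (p′ : A) → RA p p′ → Σ B λ q′ → RB q q′ × Q p′ q′

  Bisimulation : (A → B → Set) → Set
  Bisimulation Q = (p : A) (q : B) → Q p q →
    ((p′ : A) → RA p p′ → Σ B λ q′ → RB q q′ × Q p′ q′) ×
    ((q′ : B) → RB q q′ → Σ A λ p′ → RA p p′ × Q p′ q′)

  Bisimilar : A → B → Set₁
  Bisimilar a b = Σ (A → B → Set) λ Q → Q a b × Bisimulation Q

module _ {A B : Set} {RA : A → A → Set} {RB : B → B → Set} where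

  Bisimulation⇒Simulation : ∀ {Q} → Bisimulation RA RB Q → Simulation RA RB Q
  Bisimulation⇒Simulation bisim p q pq = proj₁ (bisim p q pq)

  Bisimulation-flip : ∀ {Q} → Bisimulation RA RB Q → Bisimulation RB RA (flip Q)
  Bisimulation-flip bisim q p pq = proj₂ (bisim p q pq) , proj₁ (bisim p q pq)

  Bisimilar-sym : ∀ {a b} → Bisimilar RA RB a b → Bisimilar RB RA b a
  Bisimilar-sym (Q , ab , bisim) = flip Q , ab , Bisimulation-flip bisim

_⨾_ : {A B C : Set} → (A → B → Set) → (B → C → Set) → A → C → Set
_⨾_ {B = B} Q Q′ a c = Σ B λ b → Q a b × Q′ b c

module _ {A B C : Set} {RA : A → A → Set} {RB : B → B → Set} {RC : C → C → Set} where

  Simulation-⨾ : ∀ {Q Q′} → Simulation RA RB Q → Simulation RB RC Q′ → Simulation RA RC (Q ⨾ Q′)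
  Simulation-⨾ sim sim′ a c (b , ab , bc) a′ a→a′ with sim a b ab a′ a→a′
  ... | b′ , b→b′ , a′b′ with sim′ b c bc b′ b→b′
  ...   | c′ , c→c′ , b′c′ = c′ , c→c′ , (b′ , a′b′ , b′c′)

  Bisimulation-⨾ : ∀ {Q Q′} → Bisimulation RA RB Q → Bisimulation RB RC Q′ → Bisimulation RA RC (Q ⨾ Q′)
  Bisimulation-⨾ bisim bisim′ a c (b , ab , bc) =
    Simulation-⨾ (Bisimulation⇒Simulation bisim) (Bisimulation⇒Simulation bisim′) a c (b , ab , bc) ,
    λ c′ c→c′ →
      let b′ , b→b′ , b′c′ = Bisimulation⇒Simulation (Bisimulation-flip bisim′) c b bc c′ c→c′
          a′ , a→a′ , a′b′ = Bisimulation⇒Simulation (Bisimulation-flip bisim) b a ab b′ b→b′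
      in a′ , a→a′ , (b′ , a′b′ , b′c′)

  Bisimilar-trans : ∀ {a b c} → Bisimilar RA RB a b → Bisimilar RB RC b c → Bisimilar RA RC a c
  Bisimilar-trans (Q , ab , bisim) (Q′ , bc , bisim′) = (Q ⨾ Q′) , (_ , ab , bc) , Bisimulation-⨾ bisim bisim′

Bisimilar-refl : {A : Set} {R : A → A → Set} (a : A) → Bisimilar R R a a
Bisimilar-refl a = _≡_ , refl , λ { p .p refl → (λ p′ m → p′ , m , refl) , (λ q′ m → q′ , m , refl) }

-- x simulates its option y, so the move x → y can be repeated forever.
simulated-step⇒Run : {X : Set} {R Q : X → X → Set} → Simulation R R Q →
                     ∀ {x y} → Q x y → R x y → Run R x
simulated-step⇒Run {X} {R} {Q} sim {x} {y} xy x→y = proj₁ ∘ trail , refl , λ n → proj₂ (proj₂ (proj₂ (trail n)))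
  where
  Step : Set
  Step = Σ X λ a → Σ X λ b → Q a b × R a b
  next : Step → Step
  next (a , b , ab , a→b) with sim a b ab b a→b
  ... | c , b→c , bc = b , c , bc , b→c
  trail : ℕ → Step
  trail zero    = x , y , xy , x→y
  trail (suc n) = next (trail n)

-- Bisimilarity is Set₁-valued, but a bisimulation relation has to be small; the
-- relation Equivalent below collects the witnesses of a Set-indexed family of
-- bisimilarities into one small bisimulation.
module CommonTargets {A : Set} (RA : A → A → Set)
  {I : Set} (T : I → Set) (RT : (i : I) → T i → T i → Set) (root : (i : I) → T i)
  {J : Set} (source : J → A) (target : J → I)
  (bisimilar : (j : J) → Bisimilar RA (RT (target j)) (source j) (root (target j))) where

  data Linked (x : A) : (i : I) → T i → Set where
    link : (j : J) {z : T (target j)} → proj₁ (bisimilar j) x z → Linked x (target j) z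

  Linked-forth : ∀ {x i z} → Linked x i z → ∀ {x′} → RA x x′ → Σ (T i) λ z′ → RT i z z′ × Linked x′ i z′
  Linked-forth (link j xz) {x′} x→x′ with proj₁ (proj₂ (proj₂ (bisimilar j)) _ _ xz) x′ x→x′
  ... | z′ , z→z′ , x′z′ = z′ , z→z′ , link j x′z′

  Linked-back : ∀ {x i z} → Linked x i z → ∀ {z′} → RT i z z′ → Σ A λ x′ → RA x x′ × Linked x′ i z′
  Linked-back (link j xz) {z′} z→z′ with proj₂ (proj₂ (proj₂ (bisimilar j)) _ _ xz) z′ z→z′
  ... | x′ , x→x′ , x′z′ = x′ , x→x′ , link j x′z′

  Equivalent : A → A → Set
  Equivalent x y = Σ I λ i → Σ (T i) λ z → Linked x i z × Linked y i z

  Equivalent-bisimulation : Bisimulation RA RA Equivalent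
  Equivalent-bisimulation x y (i , z , xz , yz) = forth , back
    where
    forth : (x′ : A) → RA x x′ → Σ A λ y′ → RA y y′ × Equivalent x′ y′
    forth x′ x→x′ with Linked-forth xz x→x′
    ... | z′ , z→z′ , x′z′ with Linked-back yz z→z′
    ...   | y′ , y→y′ , y′z′ = y′ , y→y′ , (i , z′ , x′z′ , y′z′)
    back : (y′ : A) → RA y y′ → Σ A λ x′ → RA x x′ × Equivalent x′ y′
    back y′ y→y′ with Linked-forth yz y→y′
    ... | z′ , z→z′ , y′z′ with Linked-back xz z→z′
    ...   | x′ , x→x′ , x′z′ = x′ , x→x′ , (i , z′ , x′z′ , y′z′)

  same-target⇒Equivalent : ∀ j₁ j₂ → target j₁ ≡ target j₂ → Equivalent (source j₁) (source j₂)
  same-target⇒Equivalent j₁ j₂ e =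
    target j₂ , root (target j₂) ,
    subst (λ i → Linked (source j₁) i (root i)) e (link j₁ (proj₁ (proj₂ (bisimilar j₁)))) ,
    link j₂ (proj₁ (proj₂ (bisimilar j₂)))

StrictlyIncreasing : (ℕ → ℕ) → Set
StrictlyIncreasing φ = (m n : ℕ) → m <ℕ n → φ m <ℕ φ n

StrictlyIncreasing⇒inflationary : ∀ {φ} → StrictlyIncreasing φ → ∀ n → n ≤ℕ φ n
StrictlyIncreasing⇒inflationary φ↑ zero    = z≤n
StrictlyIncreasing⇒inflationary φ↑ (suc n) = ℕ.≤-trans (s≤s (StrictlyIncreasing⇒inflationary φ↑ n)) (φ↑ n (suc n) (ℕ.n<1+n n))

InfinitelyOften : (ℕ → Set) → Set
InfinitelyOften P = (N : ℕ) → Σ ℕ λ n → N ≤ℕ n × P n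

stepwise⇒chain : {A : Set} (R : A → A → Set) → (∀ {x y z} → R x y → R y z → R x z) →
                 (a : ℕ → A) → (∀ n → R (a n) (a (suc n))) → ∀ m n → m <ℕ n → R (a m) (a n)
stepwise⇒chain R trans′ a step m (suc n) m<1+n with ℕ.m≤n⇒m<n∨m≡n (ℕ.≤-pred m<1+n)
... | inj₁ m<n  = trans′ (stepwise⇒chain R trans′ a step m n m<n) (step n)
... | inj₂ refl = step m

record Subsequence (P : ℕ → Set) (Q : ℕ → ℕ → Set) : Set where
  field
    index  : ℕ → ℕ
    step   : ∀ k → index k <ℕ index (suc k)
    holds  : ∀ k → P (index k)
    linked : ∀ k → Q (index k) (index (suc k))

  increasing : StrictlyIncreasing index
  increasing = stepwise⇒chain _<ℕ_ ℕ.<-trans index step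

-- index 0 reduces to n₀; stuttering-run relies on this.
iterate : ∀ {P Q} n₀ → P n₀ → (∀ n → P n → Σ ℕ λ m → n <ℕ m × P m × Q n m) → Subsequence P Q
iterate {P} {Q} n₀ p₀ next = record
  { index = λ k → proj₁ (walk k) ; step = step ; holds = λ k → proj₂ (walk k) ; linked = linked }
  where
  walk : ℕ → Σ ℕ P
  walk zero    = n₀ , p₀
  walk (suc k) = let m , _ , pm , _ = next (proj₁ (walk k)) (proj₂ (walk k)) in m , pm
  step : ∀ k → proj₁ (walk k) <ℕ proj₁ (walk (suc k))
  step k = proj₁ (proj₂ (next (proj₁ (walk k)) (proj₂ (walk k))))
  linked : ∀ k → Q (proj₁ (walk k)) (proj₁ (walk (suc k)))
  linked k = proj₂ (proj₂ (proj₂ (next (proj₁ (walk k)) (proj₂ (walk k)))))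

InfinitelyOften⇒Subsequence : ∀ {P} → InfinitelyOften P → Subsequence P (λ _ _ → ⊤)
InfinitelyOften⇒Subsequence io =
  let n₀ , _ , p₀ = io 0 in
  iterate n₀ p₀ λ n _ → let m , n<m , pm = io (suc n) in m , n<m , pm , tt

ascending-steps⇒ascending : {A : Set} (_≼_ : A → A → Set) → (∀ {x} → x ≼ x) → (∀ {x y z} → x ≼ y → y ≼ z → x ≼ z) →
                            (g : ℕ → A) → (∀ k → g k ≼ g (suc k)) → ∀ m n → m ≤ℕ n → g m ≼ g n
ascending-steps⇒ascending _≼_ refl≼ trans≼ g step m n m≤n with ℕ.m≤n⇒m<n∨m≡n m≤n
... | inj₁ m<n  = stepwise⇒chain _≼_ trans≼ g step m n m<n
... | inj₂ refl = refl≼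

stuttering-run : {X : Set} (R : X → X → Set) (u : ℕ → X) →
                 (∀ n → R (u n) (u (suc n)) ⊎ u n ≡ u (suc n)) →
                 InfinitelyOften (λ n → R (u n) (u (suc n))) → Run R (u 0)
stuttering-run R u step moves =
  u ∘ index , sym (proj₂ (proj₂ (proj₂ (first-move 0)))) , λ k → subst (R _) (linked k) (holds k)
  where
  Move : ℕ → Set
  Move n = R (u n) (u (suc n))
  first-move-within : ∀ N d → Move (d + N) → Σ ℕ λ n → N ≤ℕ n × Move n × u N ≡ u n
  first-move-within N zero    mv = N , ℕ.≤-refl , mv , refl
  first-move-within N (suc d) mv with step N
  ... | inj₁ mvN = N , ℕ.≤-refl , mvN , refl
  ... | inj₂ uN≡ =
    let n , N<n , mvn , eq = first-move-within (suc N) d (subst Move (sym (ℕ.+-suc d N)) mv)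
    in n , ℕ.<⇒≤ N<n , mvn , trans uN≡ eq
  first-move : ∀ N → Σ ℕ λ n → N ≤ℕ n × Move n × u N ≡ u n
  first-move N = let n , N≤n , mv = moves N in
    first-move-within N (n ∸ N) (subst Move (sym (ℕ.m∸n+n≡m N≤n)) mv)
  move-times : Subsequence Move (λ n m → u (suc n) ≡ u m)
  move-times = iterate (proj₁ (first-move 0)) (proj₁ (proj₂ (proj₂ (first-move 0)))) λ n _ → first-move (suc n)
  open Subsequence move-times

module Classical (em : ExcludedMiddle (Level.suc 0ℓ)) where

  dec : (P : Set) → Dec P
  dec P = map′ lower lift em

  dne : {P : Set} → ¬ ¬ P → P
  dne {P} = decidable-stable (dec P)

  dne₁ : {P : Set₁} → ¬ ¬ P → P
  dne₁ = decidable-stable em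

  eventually-not : ∀ {P} → ¬ InfinitelyOften P → Σ ℕ λ N → ∀ n → N ≤ℕ n → ¬ P n
  eventually-not ¬io = dne λ never → ¬io λ N → dne λ none → never (N , λ n N≤n pn → none (n , N≤n , pn))

  infinite-pigeonhole : ∀ {N} (κ : ℕ → Fin N) → Σ (Fin N) λ k → InfinitelyOften (λ n → κ n ≡ k)
  infinite-pigeonhole {zero} κ with κ 0
  ... | ()
  infinite-pigeonhole {suc N} κ with dec (InfinitelyOften (λ n → κ n ≡ Fin.zero))
  ... | yes io  = Fin.zero , io
  ... | no ¬io = Fin.suc k , λ N′ →
    let n , N′≤n , κ′n≡k = io N′ in
    M + n , ℕ.≤-trans N′≤n (ℕ.m≤n+m n M) , trans (sym (Finₚ.punchIn-punchOut {i = Fin.zero} (avoid n))) (cong Fin.suc κ′n≡k)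
    where
    M = proj₁ (eventually-not ¬io)
    avoid : ∀ n → Fin.zero ≢ κ (M + n)
    avoid n e = proj₂ (eventually-not ¬io) (M + n) (ℕ.m≤m+n M n) (sym e)
    κ′ : ℕ → Fin N
    κ′ n = punchOut (avoid n)
    k = proj₁ (infinite-pigeonhole κ′)
    io = proj₂ (infinite-pigeonhole κ′)

  module _ {A : Set} (_≼_ : A → A → Set) (f : ℕ → A) where

    private
      Terminal : ℕ → Set
      Terminal n = ¬ Σ ℕ λ m → n <ℕ m × f n ≼ f m

    bad-or-ascending :
      (Σ (ℕ → ℕ) λ φ → StrictlyIncreasing φ × (∀ m n → m <ℕ n → ¬ (f (φ m) ≼ f (φ n)))) ⊎
      (Σ (ℕ → ℕ) λ φ → StrictlyIncreasing φ × (∀ k → f (φ k) ≼ f (φ (suc k))))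
    bad-or-ascending with dec (InfinitelyOften Terminal)
    ... | yes io = inj₁ (index , increasing , λ m n m<n fm≼fn → holds m (index n , increasing m n m<n , fm≼fn))
      where open Subsequence (InfinitelyOften⇒Subsequence io)
    ... | no ¬io = inj₂ (index , increasing , linked)
      where
      N = proj₁ (eventually-not ¬io)
      successor : ∀ n → N ≤ℕ n → Σ ℕ λ m → n <ℕ m × N ≤ℕ m × f n ≼ f m
      successor n N≤n =
        let m , n<m , fn≼fm = dne (proj₂ (eventually-not ¬io) n N≤n) in m , n<m , ℕ.≤-trans N≤n (ℕ.<⇒≤ n<m) , fn≼fm
      chain : Subsequence (N ≤ℕ_) (λ m n → f m ≼ f n)
      chain = iterate N ℕ.≤-refl successor
      open Subsequence chain

  FiniteSubset⇒IsWPO : {S : Set} {_≼_ : S → S → Set} {P : S → Set₁} → (∀ {i} → i ≼ i) →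
                       FiniteSubset P → IsWPO _≼_ P
  FiniteSubset⇒IsWPO {_≼_ = _≼_} refl≼ (N , e , listed) f Pf =
    index , increasing , λ m n _ → subst₂ _≼_ (sym (constant m)) (sym (constant n)) refl≼
    where
    κ : ℕ → Fin N
    κ n = proj₁ (listed (f n) (Pf n))
    k = proj₁ (infinite-pigeonhole κ)
    open Subsequence (InfinitelyOften⇒Subsequence (proj₂ (infinite-pigeonhole κ)))
    constant : ∀ m → f (index m) ≡ e k
    constant m = trans (sym (proj₂ (listed (f (index m)) (Pf (index m))))) (cong e (holds m))

  ¬FiniteSubset⇒injective-sequence : {S : Set} {P : S → Set₁} → ¬ FiniteSubset P →
    Σ (ℕ → S) λ f → (∀ n → P (f n)) × (∀ m n → m <ℕ n → f m ≢ f n)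
  ¬FiniteSubset⇒injective-sequence {S} {P} infinite = element , (λ n → proj₁ (proj₂ (fresh n (prefix n)))) , distinct
    where
    fresh : (N : ℕ) (e : Fin N → S) → Σ S λ i → P i × ∀ k → e k ≢ i
    fresh N e with em {Σ S λ i → P i × ∀ k → e k ≢ i}
    ... | yes new = new
    ... | no none = ⊥-elim (infinite (N , e , λ i Pi → dne λ unlisted → none (i , Pi , λ k ek≡i → unlisted (k , ek≡i))))
    prefix : (n : ℕ) → Fin n → S
    element : ℕ → S
    prefix (suc n) Fin.zero    = element n
    prefix (suc n) (Fin.suc k) = prefix n k
    element n = proj₁ (fresh n (prefix n))
    listed : ∀ m n → m <ℕ n → Σ (Fin n) λ k → prefix n k ≡ element m
    listed m (suc n) m<1+n with ℕ.m≤n⇒m<n∨m≡n (ℕ.≤-pred m<1+n)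
    ... | inj₁ m<n  = let k , e = listed m n m<n in Fin.suc k , e
    ... | inj₂ refl = Fin.zero , refl
    distinct : ∀ m n → m <ℕ n → element m ≢ element n
    distinct m n m<n eq = let k , e = listed m n m<n in proj₂ (proj₂ (fresh n (prefix n))) k (trans e eq)

∑ : (m : ℕ) → (Fin m → ℕ) → ℕ
∑ zero    g = 0
∑ (suc m) g = g Fin.zero + ∑ m (g ∘ Fin.suc)

term≤∑ : ∀ {m} (g : Fin m → ℕ) (k : Fin m) → g k ≤ℕ ∑ m g
term≤∑ g Fin.zero    = ℕ.m≤m+n (g Fin.zero) _
term≤∑ g (Fin.suc k) = ℕ.≤-trans (term≤∑ (g ∘ Fin.suc) k) (ℕ.m≤n+m _ (g Fin.zero))

module OrderedJoinProperties (em : ExcludedMiddle (Level.suc 0ℓ)) {S : Set} (_≤_ : S → S → Set)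
  (po : IsPartialOrder _≡_ _≤_) (G : S → Game) where

  open Classical em
  open OrderedJoin _≤_ G
  open IsPartialOrder po using (antisym) renaming (refl to ≤-refl; trans to ≤-trans)

  _≐_ : JPos → JPos → Set
  X ≐ Y = ∀ j → X j ≡ Y j

  Dead : (i : S) → State i → Set
  Dead i x = ∀ y → ¬ StMove i x y

  zero-dead : ∀ {i} → Dead i (inj₂ tt)
  zero-dead (inj₁ _) ()
  zero-dead (inj₂ _) ()

  StMove⇒nonzero : ∀ {i x y} → StMove i x y → x ≢ inj₂ tt
  StMove⇒nonzero {x = inj₁ _} {inj₁ _} _ ()

  stuck-start : ∀ j → (∀ p → ¬ _⇒_ (G j) (start (G j)) p) → Dead j (inj₁ (start (G j)))
  stuck-start j no-move (inj₁ p) m = no-move p m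

  StMove-from : ∀ {i p y} → StMove i (inj₁ p) y → Σ (Pos (G i)) λ p′ → y ≡ inj₁ p′ × _⇒_ (G i) p p′
  StMove-from {y = inj₁ p′} m = p′ , refl , m

  -- The zero state is read as the start position; it has no moves, so this junk value is harmless.
  position : ∀ {i} → State i → Pos (G i)
  position (inj₁ p) = p
  position {i} (inj₂ _) = start (G i)

  StMove⇒move : ∀ {i x y} → StMove i x y → _⇒_ (G i) (position x) (position y)
  StMove⇒move {x = inj₁ _} {inj₁ _} m = m

  place : (i : S) → State i → JPos → JPos
  place i x F j with dec (i ≤ j)
  ... | no _ = F j
  ... | yes _ with dec (i ≡ j)
  ...   | yes refl = x
  ...   | no _     = inj₂ tt

  place-self : ∀ i x F → place i x F i ≡ x
  place-self i x F with dec (i ≤ i)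
  ... | no i≰i = ⊥-elim (i≰i ≤-refl)
  ... | yes _ with dec (i ≡ i)
  ...   | yes refl = refl
  ...   | no i≢i   = ⊥-elim (i≢i refl)

  place-above : ∀ i x F j → i ≤ j → i ≢ j → place i x F j ≡ inj₂ tt
  place-above i x F j i≤j i≢j with dec (i ≤ j)
  ... | no i≰j = ⊥-elim (i≰j i≤j)
  ... | yes _ with dec (i ≡ j)
  ...   | yes i≡j = ⊥-elim (i≢j i≡j)
  ...   | no _    = refl

  place-outside : ∀ i x F j → ¬ (i ≤ j) → place i x F j ≡ F j
  place-outside i x F j i≰j with dec (i ≤ j)
  ... | no _    = refl
  ... | yes i≤j = ⊥-elim (i≰j i≤j)

  place-cong : ∀ i x F F′ j → (¬ (i ≤ j) → F j ≡ F′ j) → place i x F j ≡ place i x F′ j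
  place-cong i x F F′ j eq with dec (i ≤ j)
  ... | no i≰j = eq i≰j
  ... | yes _ with dec (i ≡ j)
  ...   | yes refl = refl
  ...   | no _     = refl

  place-move : ∀ i x F → StMove i (F i) x → JMove F (place i x F)
  place-move i x F m =
    i , subst (StMove i (F i)) (sym (place-self i x F)) m , place-above i x F , place-outside i x F

  data Effect (F F′ : JPos) (c j : S) : Set where
    moved  : c ≡ j → StMove j (F j) (F′ j) → Effect F F′ c j
    zeroed : c ≤ j → c ≢ j → F′ j ≡ inj₂ tt → Effect F F′ c j
    kept   : ¬ (c ≤ j) → F′ j ≡ F j → Effect F F′ c j

  effect : ∀ {F F′} (m : JMove F F′) j → Effect F F′ (proj₁ m) j
  effect (c , m , above , outside) j with dec (c ≤ j)
  ... | no c≰j = kept c≰j (outside j c≰j)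
  ... | yes c≤j with dec (c ≡ j)
  ...   | yes refl = moved refl m
  ...   | no c≢j   = zeroed c≤j c≢j (above j c≤j c≢j)

  JMove-respects-≐ : ∀ {X X′ Y} → X ≐ X′ → JMove X Y → JMove X′ Y
  JMove-respects-≐ {Y = Y} X≐X′ (c , m , above , outside) =
    c , subst (λ z → StMove c z (Y c)) (X≐X′ c) m , above , λ j c≰j → trans (outside j c≰j) (X≐X′ j)

  ≐-sym : ∀ {X Y} → X ≐ Y → Y ≐ X
  ≐-sym X≐Y j = sym (X≐Y j)

  ≐-simulation : Simulation JMove JMove _≐_
  ≐-simulation X Y X≐Y X′ m = X′ , JMove-respects-≐ X≐Y m , λ _ → refl

  ≐-bisimulation : Bisimulation JMove JMove _≐_
  ≐-bisimulation X Y X≐Y =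
    ≐-simulation X Y X≐Y , λ Y′ m → Y′ , JMove-respects-≐ (≐-sym X≐Y) m , λ _ → refl

  ≐⇒Bisimilar : ∀ {X Y} → X ≐ Y → Bisimilar JMove JMove X Y
  ≐⇒Bisimilar X≐Y = _≐_ , X≐Y , ≐-bisimulation

  -- Terminating joins

  Terminating⇒Terminating-component : Terminating join → ∀ i → Terminating (G i)
  Terminating⇒Terminating-component term i (t , t₀ , steps) = term (s , refl , s-steps)
    where
    s : ℕ → JPos
    s zero    = start join
    s (suc n) = place i (inj₁ (t (suc n))) (s n)
    s-at-i : ∀ n → s n i ≡ inj₁ (t n)
    s-at-i zero    = cong inj₁ (sym t₀)
    s-at-i (suc n) = place-self i _ (s n)
    s-steps : ∀ n → JMove (s n) (s (suc n))
    s-steps n = place-move i _ (s n) (subst (λ z → StMove i z (inj₁ (t (suc n)))) (sym (s-at-i n)) (steps n))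

  no-move⇒≈𝟘 : ∀ i → ¬ (Σ (Pos (G i)) λ p → _⇒_ (G i) (start (G i)) p) → G i ≈ 𝟘
  no-move⇒≈𝟘 i no-move = (λ p _ → p ≡ start (G i)) , refl , λ { p tt refl →
    (λ p′ m → ⊥-elim (no-move (p′ , m))) , λ _ () }

  ≈𝟘⇒no-move : ∀ i → G i ≈ 𝟘 → (p : Pos (G i)) → ¬ _⇒_ (G i) (start (G i)) p
  ≈𝟘⇒no-move i (R , r , bisim) p m with proj₁ (bisim _ _ r) p m
  ... | _ , () , _

  InSupport⇒move : ∀ i → InSupport i → Σ (Pos (G i)) λ p → _⇒_ (G i) (start (G i)) p
  InSupport⇒move i i∈supp = dne λ no-move → i∈supp (no-move⇒≈𝟘 i no-move)

  -- Moving in f 0, f 1, ... in turn never disturbs a later f n, as no f m ≤ f n with m < n.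
  bad-sequence⇒Run : (f : ℕ → S) → (∀ n → InSupport (f n)) → (∀ m n → m <ℕ n → ¬ (f m ≤ f n)) →
                     Run JMove (start join)
  bad-sequence⇒Run f f∈supp bad = s , refl , s-steps
    where
    opening : ∀ n → Σ (Pos (G (f n))) λ p → _⇒_ (G (f n)) (start (G (f n))) p
    opening n = InSupport⇒move (f n) (f∈supp n)
    s : ℕ → JPos
    s zero    = start join
    s (suc n) = place (f n) (inj₁ (proj₁ (opening n))) (s n)
    untouched : ∀ n j → (∀ m → m <ℕ n → ¬ (f m ≤ j)) → s n j ≡ inj₁ (start (G j))
    untouched zero    j _       = refl
    untouched (suc n) j earlier = trans (place-outside (f n) _ (s n) j (earlier n (ℕ.n<1+n n)))
                                        (untouched n j (λ m m<n → earlier m (ℕ.m<n⇒m<1+n m<n)))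
    s-steps : ∀ n → JMove (s n) (s (suc n))
    s-steps n = place-move (f n) _ (s n)
      (subst (λ z → StMove (f n) z (inj₁ (proj₁ (opening n)))) (sym (untouched n (f n) (λ m m<n → bad m n m<n)))
             (proj₂ (opening n)))

  Terminating⇒IsWPO : Terminating join → IsWPO _≤_ InSupport
  Terminating⇒IsWPO term f f∈supp with bad-or-ascending _≤_ f
  ... | inj₁ (φ , _ , bad)     = ⊥-elim (term (bad-sequence⇒Run (f ∘ φ) (f∈supp ∘ φ) bad))
  ... | inj₂ (φ , φ↑ , ascend) = φ , φ↑ , ascending-steps⇒ascending _≤_ ≤-refl ≤-trans (f ∘ φ) ascend

  module InfinitePlay (wpo : IsWPO _≤_ InSupport) (run : Run JMove (start join)) where

    s : ℕ → JPos
    s = proj₁ run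

    s₀ : s zero ≡ start join
    s₀ = proj₁ (proj₂ run)

    steps : ∀ n → JMove (s n) (s (suc n))
    steps = proj₂ (proj₂ run)

    mover : ℕ → S
    mover n = proj₁ (steps n)

    mover-nonzero : ∀ n → s n (mover n) ≢ inj₂ tt
    mover-nonzero n = StMove⇒nonzero (proj₁ (proj₂ (steps n)))

    s₀-at : ∀ j → s zero j ≡ inj₁ (start (G j))
    s₀-at j = cong-app s₀ j

    zero-persists : ∀ j {n m} → n ≤ℕ m → s n j ≡ inj₂ tt → s m j ≡ inj₂ tt
    zero-persists j {n} {m} = ascending-steps⇒ascending (λ n m → s n j ≡ inj₂ tt → s m j ≡ inj₂ tt)
                                id (λ f g → g ∘ f) id one-step n m
      where
      one-step : ∀ n → s n j ≡ inj₂ tt → s (suc n) j ≡ inj₂ tt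
      one-step n is-zero with effect (steps n) j
      ... | moved _ m           = ⊥-elim (StMove⇒nonzero m is-zero)
      ... | zeroed _ _ is-zero′ = is-zero′
      ... | kept _ same         = trans same is-zero

    start-or-zero : ∀ j → (∀ p → ¬ _⇒_ (G j) (start (G j)) p) → ∀ n →
                    s n j ≡ inj₁ (start (G j)) ⊎ s n j ≡ inj₂ tt
    start-or-zero j no-move zero = inj₁ (s₀-at j)
    start-or-zero j no-move (suc n) with effect (steps n) j | start-or-zero j no-move n
    ... | moved _ m          | inj₁ at-start = ⊥-elim (subst (Dead j) (sym at-start) (stuck-start j no-move) _ m)
    ... | moved _ m          | inj₂ is-zero  = ⊥-elim (StMove⇒nonzero m is-zero)
    ... | zeroed _ _ is-zero | _             = inj₂ is-zero
    ... | kept _ same        | inj₁ at-start = inj₁ (trans same at-start)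
    ... | kept _ same        | inj₂ is-zero  = inj₂ (trans same is-zero)

    mover-InSupport : ∀ n → InSupport (mover n)
    mover-InSupport n ≈𝟘 with start-or-zero (mover n) (≈𝟘⇒no-move (mover n) ≈𝟘) n
    ... | inj₁ at-start = subst (Dead (mover n)) (sym at-start) (stuck-start (mover n) (≈𝟘⇒no-move (mover n) ≈𝟘)) _
                            (proj₁ (proj₂ (steps n)))
    ... | inj₂ is-zero = mover-nonzero n is-zero

    φ : ℕ → ℕ
    φ = proj₁ (wpo mover mover-InSupport)

    φ↑ : StrictlyIncreasing φ
    φ↑ = proj₁ (proj₂ (wpo mover mover-InSupport))

    ascending : ∀ m n → m ≤ℕ n → mover (φ m) ≤ mover (φ n)
    ascending = proj₂ (proj₂ (wpo mover mover-InSupport))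

    a : S
    a = mover (φ zero)

    φ-≥ : ∀ n → n ≤ℕ φ n
    φ-≥ = StrictlyIncreasing⇒inflationary φ↑

    mover-φ : ∀ m → mover (φ m) ≡ a
    mover-φ zero    = refl
    mover-φ (suc m) = dne λ different → mover-nonzero (φ (suc m))
      (zero-persists (mover (φ (suc m))) (φ↑ zero (suc m) (s≤s z≤n))
        (proj₁ (proj₂ (proj₂ (steps (φ zero)))) _ (ascending zero (suc m) z≤n) (different ∘ sym)))

    a-nonzero : ∀ n → s n a ≢ inj₂ tt
    a-nonzero n is-zero = mover-nonzero (φ n)
      (subst (λ j → s (φ n) j ≡ inj₂ tt) (sym (mover-φ n)) (zero-persists a (φ-≥ n) is-zero))

    a-stutters : ∀ n → StMove a (s n a) (s (suc n) a) ⊎ s n a ≡ s (suc n) a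
    a-stutters n with effect (steps n) a
    ... | moved _ m          = inj₁ m
    ... | zeroed _ _ is-zero = ⊥-elim (a-nonzero (suc n) is-zero)
    ... | kept _ same        = inj₂ (sym same)

    a-moves : InfinitelyOften (λ n → StMove a (s n a) (s (suc n) a))
    a-moves N = φ N , φ-≥ N ,
      subst (λ j → StMove j (s (φ N) j) (s (suc (φ N)) j)) (mover-φ N) (proj₁ (proj₂ (steps (φ N))))

    component-Run : Run (_⇒_ (G a)) (start (G a))
    component-Run = subst (Run (_⇒_ (G a))) (cong position (s₀-at a))
      (Run-map {R′ = _⇒_ (G a)} position (λ {x} {y} → StMove⇒move {a} {x} {y}) (stuttering-run (StMove a) (λ n → s n a) a-stutters a-moves))

  IsWPO⇒Terminating : IsWPO _≤_ InSupport → (∀ i → Terminating (G i)) → Terminating join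
  IsWPO⇒Terminating wpo term run = term a component-Run
    where open InfinitePlay wpo run

  -- Reachable positions

  Reachable≐ : JPos → Set
  Reachable≐ X = Σ JPos λ Y → Reachable join Y × Y ≐ X

  Reachable≐-start : Reachable≐ (start join)
  Reachable≐-start = start join , here , λ _ → refl

  Reachable≐-step : ∀ {X Y Z} → Reachable≐ X → JMove X Y → Y ≐ Z → Reachable≐ Z
  Reachable≐-step (X₀ , r , X₀≐X) m Y≐Z = _ , there r (JMove-respects-≐ (≐-sym X₀≐X) m) , Y≐Z

  Terminating⇒no-Run : Terminating join → ∀ {X} → Reachable≐ X → ¬ Run JMove X
  Terminating⇒no-Run term {X} (Y , r , Y≐X) run =
    reachable-Run⇒¬Terminating join r (Run-transport (λ {Z} → JMove-respects-≐ {X} {Y} {Z} (≐-sym Y≐X)) run) term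

  Terminating⇒no-simulated-step : Terminating join → ∀ {Q X Y} → Reachable≐ X →
                                  Simulation JMove JMove Q → Q X Y → ¬ JMove X Y
  Terminating⇒no-simulated-step term X-reach sim XY m = Terminating⇒no-Run term X-reach (simulated-step⇒Run sim XY m)

  reachable-state : ∀ {X} → Reachable join X → ∀ j →
                    X j ≡ inj₂ tt ⊎ Σ (Pos (G j)) λ p → X j ≡ inj₁ p × Reachable (G j) p
  reachable-state here j = inj₂ (start (G j) , refl , here)
  reachable-state (there {_} {X′} r m) j with effect m j | reachable-state r j
  ... | moved _ mj | inj₁ is-zero = ⊥-elim (StMove⇒nonzero mj is-zero)
  ... | moved _ mj | inj₂ (p , at-p , p-reach) =
    let p′ , at-p′ , p→p′ = StMove-from (subst (λ z → StMove j z (X′ j)) at-p mj) in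
    inj₂ (p′ , at-p′ , there p-reach p→p′)
  ... | zeroed _ _ is-zero | _ = inj₁ is-zero
  ... | kept _ same | inj₁ is-zero = inj₁ (trans same is-zero)
  ... | kept _ same | inj₂ (p , at-p , p-reach) = inj₂ (p , trans same at-p , p-reach)

  only-start-reachable : ∀ {j} → (∀ p → ¬ _⇒_ (G j) (start (G j)) p) → ∀ {p} → Reachable (G j) p → p ≡ start (G j)
  only-start-reachable no-move here = refl
  only-start-reachable {j} no-move (there r m) =
    ⊥-elim (no-move _ (subst (λ z → _⇒_ (G j) z _) (only-start-reachable no-move r) m))

  outside-support-Dead : ∀ {X} → Reachable≐ X → ∀ j → ¬ InSupport j → Dead j (X j)
  outside-support-Dead (Y , r , Y≐X) j j∉supp with reachable-state r j
  ... | inj₁ is-zero = subst (Dead j) (trans (sym is-zero) (Y≐X j)) zero-dead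
  ... | inj₂ (p , at-p , p-reach) = subst (Dead j) (trans (sym at-p) (Y≐X j))
          (subst (λ q → Dead j (inj₁ q)) (sym (only-start-reachable no-move p-reach)) (stuck-start j no-move))
    where no-move = ≈𝟘⇒no-move j (dne₁ j∉supp)

  Dead-preserved : ∀ {X Y} → JMove X Y → ∀ j → Dead j (X j) → Dead j (Y j)
  Dead-preserved m j dead with effect m j
  ... | moved _ mj         = ⊥-elim (dead _ mj)
  ... | zeroed _ _ is-zero = subst (Dead j) (sym is-zero) zero-dead
  ... | kept _ same        = subst (Dead j) (sym same) dead

  PlayedAbove : S → JPos → JPos → Set
  PlayedAbove c X Y = Reachable≐ Y × (∀ j → ¬ (c ≤ j) → Y j ≡ X j) × (∀ j → Dead j (X j) → Dead j (Y j))

  -- Keep moving in component c; termination forces it to die eventually.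
  exhaust : Terminating join → ∀ {X} → Reachable≐ X → (c : S) → Σ JPos λ Y → PlayedAbove c X Y × Dead c (Y c)
  exhaust term {X} X-reach c = dne λ never → Terminating⇒no-Run term X-reach (play never)
    where
    Goal : Set
    Goal = Σ JPos λ Y → PlayedAbove c X Y × Dead c (Y c)
    continue : ¬ Goal → (Y : Σ JPos (PlayedAbove c X)) → Σ (Σ JPos (PlayedAbove c X)) λ Y′ → JMove (proj₁ Y) (proj₁ Y′)
    continue never (Y , Y-reach , unchanged , dead) with dec (Σ (State c) λ z → StMove c (Y c) z)
    ... | no stuck = ⊥-elim (never (Y , (Y-reach , unchanged , dead) , λ z m → stuck (z , m)))
    ... | yes (z , m) = (place c z Y ,
                          Reachable≐-step Y-reach (place-move c z Y m) (λ _ → refl) ,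
                          (λ j c≰j → trans (place-outside c z Y j c≰j) (unchanged j c≰j)) ,
                          (λ j d → Dead-preserved (place-move c z Y m) j (dead j d))) ,
                        place-move c z Y m
    play : ¬ Goal → Run JMove X
    play never = proj₁ ∘ trail , refl , λ n → proj₂ (continue never (trail n))
      where
      trail : ℕ → Σ JPos (PlayedAbove c X)
      trail zero    = X , X-reach , (λ _ _ → refl) , (λ _ d → d)
      trail (suc n) = proj₁ (continue never (trail n))

  -- Short joins

  opening : (i : S) → InSupport i → JPos
  opening i i∈supp = place i (inj₁ (proj₁ (InSupport⇒move i i∈supp))) (start join)

  opening-reachable : ∀ i i∈supp → Reachable join (opening i i∈supp)
  opening-reachable i i∈supp = there here (place-move i _ (start join) (proj₂ (InSupport⇒move i i∈supp)))

  -- Opening A from the position opening B leads to a position ≐ opening A, so opening B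
  -- would simulate one of its own options.
  openings-not-bisimilar : Terminating join → ∀ {A B} A∈supp B∈supp → A ≤ B → A ≢ B →
                           ¬ Bisimilar JMove JMove (opening B B∈supp) (opening A A∈supp)
  openings-not-bisimilar term {A} {B} A∈supp B∈supp A≤B A≢B (Q , BA , bisim) =
    Terminating⇒no-simulated-step term (_ , opening-reachable B B∈supp , λ _ → refl)
      (Simulation-⨾ (Bisimulation⇒Simulation bisim) ≐-simulation) (opening A A∈supp , BA , ≐-sym reopened) move
    where
    B≰A : ¬ (B ≤ A)
    B≰A B≤A = A≢B (antisym A≤B B≤A)
    reopen : JPos
    reopen = place A (inj₁ (proj₁ (InSupport⇒move A A∈supp))) (opening B B∈supp)
    move : JMove (opening B B∈supp) reopen
    move = place-move A _ _ (subst (λ z → StMove A z _) (sym (place-outside B _ (start join) A B≰A))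
                                   (proj₂ (InSupport⇒move A A∈supp)))
    reopened : reopen ≐ opening A A∈supp
    reopened j = place-cong A _ _ _ j λ A≰j → place-outside B _ (start join) j (λ B≤j → A≰j (≤-trans A≤B B≤j))

  Short⇒FiniteSubset : Short join → FiniteSubset InSupport
  Short⇒FiniteSubset (term , n , games , cover) = dne₁ not-infinite
    where
    not-infinite : ¬ ¬ FiniteSubset InSupport
    not-infinite infinite =
      openings-not-bisimilar term (f∈supp _) (f∈supp _) (ascending _ _ (ℕ.<⇒≤ x<y)) (distinct _ _ (φ↑ _ _ x<y))
        (Bisimilar-trans (covered y) (Bisimilar-sym (subst (λ k → at join (opening (i x) (f∈supp _)) ≈ games k) same (covered x))))
      where
      sequence = ¬FiniteSubset⇒injective-sequence infinite
      f : ℕ → S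
      f = proj₁ sequence
      f∈supp : ∀ n → InSupport (f n)
      f∈supp = proj₁ (proj₂ sequence)
      distinct : ∀ m n → m <ℕ n → f m ≢ f n
      distinct = proj₂ (proj₂ sequence)
      wpo = Terminating⇒IsWPO term f f∈supp
      φ : ℕ → ℕ
      φ = proj₁ wpo
      φ↑ : StrictlyIncreasing φ
      φ↑ = proj₁ (proj₂ wpo)
      ascending : ∀ m n → m ≤ℕ n → f (φ m) ≤ f (φ n)
      ascending = proj₂ (proj₂ wpo)
      i : Fin (suc n) → S
      i x = f (φ (toℕ x))
      class : Fin (suc n) → Fin n
      class x = proj₁ (cover _ (opening-reachable (i x) (f∈supp _)))
      covered : ∀ x → at join (opening (i x) (f∈supp _)) ≈ games (class x)
      covered x = proj₂ (cover _ (opening-reachable (i x) (f∈supp _)))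
      collision = Finₚ.pigeonhole (ℕ.n<1+n n) class
      x y : Fin (suc n)
      x = proj₁ collision
      y = proj₁ (proj₂ collision)
      x<y : toℕ x <ℕ toℕ y
      x<y = proj₁ (proj₂ (proj₂ collision))
      same : class x ≡ class y
      same = proj₂ (proj₂ (proj₂ collision))

  -- G i embeds into the join by p ↦ place i p K, where K has played out the components
  -- incomparable with i (only finitely many of them can move). Bisimilarity is reflected:
  -- a reply below i in the join could be copied by the other side, a simulated step.
  module ShortComponent (short : Short join) (i : S) where

    term : Terminating join
    term = proj₁ short

    Isolated : (m : ℕ) → (Fin m → S) → JPos → Set
    Isolated m e Y = Reachable≐ Y × Y i ≡ inj₁ (start (G i)) ×
                     ((k : Fin m) → ¬ (e k ≤ i) → ¬ (i ≤ e k) → Dead (e k) (Y (e k)))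

    isolate : (m : ℕ) (e : Fin m → S) → Σ JPos (Isolated m e)
    isolate zero e = start join , Reachable≐-start , refl , λ ()
    isolate (suc m) e with isolate m (e ∘ Fin.suc) | dec (¬ (e Fin.zero ≤ i) × ¬ (i ≤ e Fin.zero))
    ... | Y , Y-reach , Y-at-i , dead | no comparable = Y , Y-reach , Y-at-i , dead′
      where
      dead′ : (k : Fin (suc m)) → ¬ (e k ≤ i) → ¬ (i ≤ e k) → Dead (e k) (Y (e k))
      dead′ Fin.zero    e≰i i≰e = ⊥-elim (comparable (e≰i , i≰e))
      dead′ (Fin.suc k) e≰i i≰e = dead k e≰i i≰e
    ... | Y , Y-reach , Y-at-i , dead | yes (e≰i , _) with exhaust term Y-reach (e Fin.zero)
    ...   | Y′ , (Y′-reach , unchanged , preserved) , dead-e =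
      Y′ , Y′-reach , trans (unchanged i e≰i) Y-at-i , dead′
      where
      dead′ : (k : Fin (suc m)) → ¬ (e k ≤ i) → ¬ (i ≤ e k) → Dead (e k) (Y′ (e k))
      dead′ Fin.zero    _   _   = dead-e
      dead′ (Fin.suc k) e≰i i≰e = preserved (e (Fin.suc k)) (dead k e≰i i≰e)

    support : FiniteSubset InSupport
    support = Short⇒FiniteSubset short

    isolated : Σ JPos (Isolated (proj₁ support) (proj₁ (proj₂ support)))
    isolated = isolate (proj₁ support) (proj₁ (proj₂ support))

    K : JPos
    K = proj₁ isolated

    K-reach : Reachable≐ K
    K-reach = proj₁ (proj₂ isolated)

    K-at-i : K i ≡ inj₁ (start (G i))
    K-at-i = proj₁ (proj₂ (proj₂ isolated))

    K-incomparable-dead : ∀ c → ¬ (c ≤ i) → ¬ (i ≤ c) → Dead c (K c)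
    K-incomparable-dead c c≰i i≰c = by-support em
      where
      by-support : Dec (InSupport c) → Dead c (K c)
      by-support (no c∉supp) = outside-support-Dead K-reach c c∉supp
      by-support (yes c∈supp) =
        let k , ek≡c = proj₂ (proj₂ support) c c∈supp in
        subst (λ c → Dead c (K c)) ek≡c
          (proj₂ (proj₂ (proj₂ isolated)) k (c≰i ∘ subst (_≤ i) ek≡c) (i≰c ∘ subst (i ≤_) ek≡c))

    embed : Pos (G i) → JPos
    embed p = place i (inj₁ p) K

    embed-at-i : ∀ p → embed p i ≡ inj₁ p
    embed-at-i p = place-self i _ K

    embed-outside : ∀ p j → ¬ (i ≤ j) → embed p j ≡ K j
    embed-outside p j i≰j = place-outside i _ K j i≰j

    Lifted : (JPos → JPos → Set) → Pos (G i) → Pos (G i) → Set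
    Lifted Q x y = Σ JPos λ X → Σ JPos λ Y → X ≐ embed x × Y ≐ embed y × Q X Y × Reachable≐ X × Reachable≐ Y

    Lifted-flip : ∀ {Q x y} → Lifted Q x y → Lifted (λ X Y → Q Y X) y x
    Lifted-flip (X , Y , X≐ , Y≐ , XY , X-reach , Y-reach) = Y , X , Y≐ , X≐ , XY , Y-reach , X-reach

    Lifted-simulation : ∀ Q → Simulation JMove JMove Q → Simulation (_⇒_ (G i)) (_⇒_ (G i)) (Lifted Q)
    Lifted-simulation Q sim x y (X , Y , X≐ , Y≐ , XY , X-reach , Y-reach) x′ x→x′ = answer (effect Y→Y′ i)
      where
      X′ : JPos
      X′ = place i (inj₁ x′) X
      X→X′ : JMove X X′
      X→X′ = place-move i _ X (subst (λ z → StMove i z (inj₁ x′)) (sym (trans (X≐ i) (embed-at-i x))) x→x′)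
      X′≐ : X′ ≐ embed x′
      X′≐ j = place-cong i _ X K j λ i≰j → trans (X≐ j) (embed-outside x j i≰j)
      response = sim X Y XY X′ X→X′
      Y′ : JPos
      Y′ = proj₁ response
      Y→Y′ : JMove Y Y′
      Y→Y′ = proj₁ (proj₂ response)
      X′Y′ : Q X′ Y′
      X′Y′ = proj₂ (proj₂ response)
      X′-reach : Reachable≐ X′
      X′-reach = Reachable≐-step X-reach X→X′ λ _ → refl
      Y′-reach : Reachable≐ Y′
      Y′-reach = Reachable≐-step Y-reach Y→Y′ λ _ → refl
      c : S
      c = proj₁ Y→Y′
      c-move : StMove c (Y c) (Y′ c)
      c-move = proj₁ (proj₂ Y→Y′)
      unchanged-outside : ∀ j → ¬ (i ≤ j) → Y j ≡ X′ j
      unchanged-outside j i≰j = trans (Y≐ j) (trans (embed-outside y j i≰j) (sym (trans (X′≐ j) (embed-outside x′ j i≰j))))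
      answer : Effect Y Y′ c i → Σ (Pos (G i)) λ y′ → _⇒_ (G i) y y′ × Lifted Q x′ y′
      answer (moved c≡i mi) = follow (StMove-from (subst (λ z → StMove i z (Y′ i)) (trans (Y≐ i) (embed-at-i y)) mi))
        where
        Y′≐ : ∀ {y′} → Y′ i ≡ inj₁ y′ → ∀ j → Effect Y Y′ c j → Y′ j ≡ embed y′ j
        Y′≐ {y′} at-y′ j (moved c≡j _) =
          subst (λ j → Y′ j ≡ embed y′ j) (trans (sym c≡i) c≡j) (trans at-y′ (sym (embed-at-i y′)))
        Y′≐ at-y′ j (zeroed c≤j c≢j is-zero) =
          trans is-zero (sym (place-above i _ K j (subst (_≤ j) c≡i c≤j) λ i≡j → c≢j (trans c≡i i≡j)))
        Y′≐ {y′} at-y′ j (kept c≰j same) =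
          trans same (trans (Y≐ j) (trans (embed-outside y j i≰j) (sym (embed-outside y′ j i≰j))))
          where
          i≰j : ¬ (i ≤ j)
          i≰j i≤j = c≰j (subst (_≤ j) (sym c≡i) i≤j)
        follow : (Σ (Pos (G i)) λ y′ → Y′ i ≡ inj₁ y′ × _⇒_ (G i) y y′) →
                 Σ (Pos (G i)) λ y′ → _⇒_ (G i) y y′ × Lifted Q x′ y′
        follow (y′ , at-y′ , y→y′) =
          y′ , y→y′ , X′ , Y′ , X′≐ , (λ j → Y′≐ at-y′ j (effect Y→Y′ j)) , X′Y′ , X′-reach , Y′-reach
      answer (zeroed c≤i c≢i _) =
        ⊥-elim (Terminating⇒no-simulated-step term X′-reach (Simulation-⨾ sim ≐-simulation)
                  (Y′ , X′Y′ , λ j → sym (copied j (effect Y→Y′ j))) copy)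
        where
        i≰c : ¬ (i ≤ c)
        i≰c i≤c = c≢i (antisym c≤i i≤c)
        Z : JPos
        Z = place c (Y′ c) X′
        copy : JMove X′ Z
        copy = place-move c _ X′ (subst (λ z → StMove c z (Y′ c)) (unchanged-outside c i≰c) c-move)
        copied : ∀ j → Effect Y Y′ c j → Z j ≡ Y′ j
        copied j (moved refl _)           = place-self c _ X′
        copied j (zeroed c≤j c≢j is-zero) = trans (place-above c _ X′ j c≤j c≢j) (sym is-zero)
        copied j (kept c≰j same) =
          trans (place-outside c _ X′ j c≰j) (sym (trans same (unchanged-outside j λ i≤j → c≰j (≤-trans c≤i i≤j))))
      answer (kept c≰i _) = ⊥-elim (stuck (dec (i ≤ c)))
        where
        stuck : Dec (i ≤ c) → ⊥
        stuck (yes i≤c) = StMove⇒nonzero c-move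
                            (trans (Y≐ c) (place-above i _ K c i≤c λ i≡c → c≰i (subst (_≤ i) i≡c ≤-refl)))
        stuck (no i≰c)  = K-incomparable-dead c c≰i i≰c _
                            (subst (λ z → StMove c z (Y′ c)) (trans (Y≐ c) (embed-outside y c i≰c)) c-move)

    Lifted-bisimulation : ∀ Q → Bisimulation JMove JMove Q → Bisimulation (_⇒_ (G i)) (_⇒_ (G i)) (Lifted Q)
    Lifted-bisimulation Q bisim x y xy =
      Lifted-simulation Q (Bisimulation⇒Simulation bisim) x y xy ,
      λ y′ y→y′ → let x′ , x→x′ , y′x′ = Lifted-simulation _ (Bisimulation⇒Simulation (Bisimulation-flip bisim))
                                            y x (Lifted-flip {Q} xy) y′ y→y′
                  in x′ , x→x′ , Lifted-flip {λ X Y → Q Y X} y′x′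

    embed-reflects-Bisimilar : ∀ {p q} → Reachable≐ (embed p) → Reachable≐ (embed q) →
                               Bisimilar JMove JMove (embed p) (embed q) → Bisimilar (_⇒_ (G i)) (_⇒_ (G i)) p q
    embed-reflects-Bisimilar {p} {q} p-reach q-reach (Q , pq , bisim) =
      Lifted Q , (embed p , embed q , (λ _ → refl) , (λ _ → refl) , pq , p-reach , q-reach) , Lifted-bisimulation Q bisim

    embed-option-reachable : ∀ {p} → Reachable (G i) p → ∀ {p′} → _⇒_ (G i) p p′ → Reachable≐ (embed p′)
    embed-option-reachable here {p′} m =
      Reachable≐-step {K} {embed p′} {embed p′} K-reach
        (place-move i (inj₁ p′) K (subst (λ z → StMove i z (inj₁ p′)) (sym K-at-i) m)) λ _ → refl
    embed-option-reachable (there {_} {p} r m₀) {p′} m =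
      Reachable≐-step {embed p} {place i (inj₁ p′) (embed p)} {embed p′} (embed-option-reachable r m₀)
        (place-move i (inj₁ p′) (embed p) (subst (λ z → StMove i z (inj₁ p′)) (sym (embed-at-i p)) m))
        λ j → place-cong i (inj₁ p′) (embed p) K j (embed-outside p j)

    n : ℕ
    n = proj₁ (proj₂ short)

    games : Fin n → Game
    games = proj₁ (proj₂ (proj₂ short))

    Embeds : Fin n → Set₁
    Embeds k = Σ (Pos (G i)) λ p → Reachable≐ (embed p) × at join (embed p) ≈ games k

    representative : (k : Fin n) → Dec (Embeds k) → Game
    representative k (yes (p , _)) = at (G i) p
    representative k (no _)        = 𝟘

    -- embed-option-reachable misses the start of G i, so it gets an index of its own.
    games′ : Fin (suc n) → Game
    games′ Fin.zero    = G i
    games′ (Fin.suc k) = representative k em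

    cover′ : (p : Pos (G i)) → Reachable (G i) p → Σ (Fin (suc n)) λ k → at (G i) p ≈ games′ k
    cover′ _ here = Fin.zero , Bisimilar-refl _
    cover′ p (there r m) = Fin.suc k , represented em
      where
      p-reach = embed-option-reachable r m
      covered = proj₂ (proj₂ (proj₂ short)) _ (proj₁ (proj₂ p-reach))
      k = proj₁ covered
      p≈k : at join (embed p) ≈ games k
      p≈k = Bisimilar-trans (≐⇒Bisimilar (≐-sym (proj₂ (proj₂ p-reach)))) (proj₂ covered)
      represented : (d : Dec (Embeds k)) → at (G i) p ≈ representative k d
      represented (yes (q , q-reach , q≈k)) = embed-reflects-Bisimilar p-reach q-reach (Bisimilar-trans p≈k (Bisimilar-sym q≈k))
      represented (no none) = ⊥-elim (none (p , p-reach , p≈k))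

    short-component : Short (G i)
    short-component = Terminating⇒Terminating-component term i , suc n , games′ , cover′

  module ShortJoin (short : ∀ i → Short (G i)) (support : FiniteSubset InSupport) where

    size : S → ℕ
    size j = proj₁ (proj₂ (short j))

    games : (j : S) → Fin (size j) → Game
    games j = proj₁ (proj₂ (proj₂ (short j)))

    cover : (j : S) (p : Pos (G j)) → Reachable (G j) p → Σ (Fin (size j)) λ k → at (G j) p ≈ games j k
    cover j = proj₂ (proj₂ (proj₂ (short j)))

    module Classes (j : S) = CommonTargets (_⇒_ (G j)) (λ k → Pos (games j k)) (λ k → _⇒_ (games j k))
      (λ k → start (games j k)) {J = Σ (Pos (G j)) (Reachable (G j))} proj₁
      (λ (p , r) → proj₁ (cover j p r)) (λ (p , r) → proj₂ (cover j p r))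

    StateEquivalent : (j : S) → State j → State j → Set
    StateEquivalent j x y = (Dead j x × Dead j y) ⊎
      (Σ (Pos (G j)) λ p → Σ (Pos (G j)) λ q → x ≡ inj₁ p × y ≡ inj₁ q × Classes.Equivalent j p q)

    StateEquivalent-sym : ∀ {j x y} → StateEquivalent j x y → StateEquivalent j y x
    StateEquivalent-sym (inj₁ (dead-x , dead-y)) = inj₁ (dead-y , dead-x)
    StateEquivalent-sym (inj₂ (p , q , at-p , at-q , (k , z , pz , qz))) = inj₂ (q , p , at-q , at-p , (k , z , qz , pz))

    _∼_ : JPos → JPos → Set
    X ∼ Y = ∀ j → StateEquivalent j (X j) (Y j)

    ∼-simulation : Simulation JMove JMove _∼_
    ∼-simulation X Y X∼Y X′ X→X′ = answer (X∼Y c)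
      where
      c : S
      c = proj₁ X→X′
      c-move : StMove c (X c) (X′ c)
      c-move = proj₁ (proj₂ X→X′)
      answer : StateEquivalent c (X c) (Y c) → Σ JPos λ Y′ → JMove Y Y′ × X′ ∼ Y′
      answer (inj₁ (dead-x , _)) = ⊥-elim (dead-x _ c-move)
      answer (inj₂ (p , q , at-p , at-q , p∼q)) = follow (StMove-from (subst (λ z → StMove c z (X′ c)) at-p c-move))
        where
        follow : (Σ (Pos (G c)) λ p′ → X′ c ≡ inj₁ p′ × _⇒_ (G c) p p′) → Σ JPos λ Y′ → JMove Y Y′ × X′ ∼ Y′
        follow (p′ , at-p′ , p→p′) = place c (inj₁ q′) Y , Y→Y′ , λ j → related j (effect X→X′ j)
          where
          matched = proj₁ (Classes.Equivalent-bisimulation c p q p∼q) p′ p→p′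
          q′ : Pos (G c)
          q′ = proj₁ matched
          Y→Y′ : JMove Y (place c (inj₁ q′) Y)
          Y→Y′ = place-move c _ Y (subst (λ z → StMove c z (inj₁ q′)) (sym at-q) (proj₁ (proj₂ matched)))
          related : ∀ j → Effect X X′ c j → StateEquivalent j (X′ j) (place c (inj₁ q′) Y j)
          related j (moved refl _) = inj₂ (p′ , q′ , at-p′ , place-self c _ Y , proj₂ (proj₂ matched))
          related j (zeroed c≤j c≢j is-zero) =
            inj₁ (subst (Dead j) (sym is-zero) zero-dead , subst (Dead j) (sym (place-above c _ Y j c≤j c≢j)) zero-dead)
          related j (kept c≰j same) =
            subst₂ (StateEquivalent j) (sym same) (sym (place-outside c _ Y j c≰j)) (X∼Y j)

    ∼-bisimulation : Bisimulation JMove JMove _∼_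
    ∼-bisimulation X Y X∼Y = ∼-simulation X Y X∼Y , λ Y′ Y→Y′ →
      let X′ , X→X′ , Y′∼X′ = ∼-simulation Y X (StateEquivalent-sym ∘ X∼Y) Y′ Y→Y′
      in X′ , X→X′ , StateEquivalent-sym ∘ Y′∼X′

    state-class : (j : S) (x : State j) → Dec (Dead j x) →
                  (x ≡ inj₂ tt ⊎ Σ (Pos (G j)) λ p → x ≡ inj₁ p × Reachable (G j) p) → Fin (suc (size j))
    state-class j x (yes _) _                  = Fin.zero
    state-class j x (no _)  (inj₁ _)           = Fin.zero
    state-class j x (no _)  (inj₂ (p , _ , r)) = Fin.suc (proj₁ (cover j p r))

    same-class⇒StateEquivalent : ∀ j x y dx rx dy ry → state-class j x dx rx ≡ state-class j y dy ry → StateEquivalent j x y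
    same-class⇒StateEquivalent j x y (yes dead-x) _ (yes dead-y) _ _ = inj₁ (dead-x , dead-y)
    same-class⇒StateEquivalent j x y (no live) (inj₁ is-zero) _ _ _ = ⊥-elim (live (subst (Dead j) (sym is-zero) zero-dead))
    same-class⇒StateEquivalent j x y _ _ (no live) (inj₁ is-zero) _ = ⊥-elim (live (subst (Dead j) (sym is-zero) zero-dead))
    same-class⇒StateEquivalent j x y (yes _) _ (no _) (inj₂ _) ()
    same-class⇒StateEquivalent j x y (no _) (inj₂ _) (yes _) _ ()
    same-class⇒StateEquivalent j x y (no _) (inj₂ (p , at-p , p-reach)) (no _) (inj₂ (q , at-q , q-reach)) same =
      inj₂ (p , q , at-p , at-q , Classes.same-target⇒Equivalent j (p , p-reach) (q , q-reach) (Finₚ.suc-injective same))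

    N : ℕ
    N = proj₁ support

    listing : Fin N → S
    listing = proj₁ (proj₂ support)

    bound : ℕ
    bound = suc (∑ N (size ∘ listing))

    signature : (X : JPos) → Reachable join X → Fin N → Fin bound
    signature X r k = inject≤ (state-class (listing k) (X (listing k)) (dec _) (reachable-state r (listing k)))
                              (s≤s (term≤∑ (size ∘ listing) k))

    code : (X : JPos) → Reachable join X → Fin (bound ^ N)
    code X r = funToFin (signature X r)

    same-code⇒∼ : ∀ {X Y} r s → code X r ≡ code Y s → X ∼ Y
    same-code⇒∼ {X} {Y} r s same j = by-support (em {InSupport j})
      where
      same-signature : ∀ k → signature X r k ≡ signature Y s k
      same-signature k = trans (sym (Finₚ.finToFun-funToFin (signature X r) k))
                               (trans (cong (λ c → finToFun c k) same) (Finₚ.finToFun-funToFin (signature Y s) k))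
      by-support : Dec (InSupport j) → StateEquivalent j (X j) (Y j)
      by-support (no j∉supp) = inj₁ (outside-support-Dead (X , r , λ _ → refl) j j∉supp ,
                                     outside-support-Dead (Y , s , λ _ → refl) j j∉supp)
      by-support (yes j∈supp) =
        let k , listed = proj₂ (proj₂ support) j j∈supp in
        subst (λ j → StateEquivalent j (X j) (Y j)) listed
          (same-class⇒StateEquivalent _ _ _ _ _ _ _ (Finₚ.inject≤-injective _ _ _ _ (same-signature k)))

    Coded : Fin (bound ^ N) → Set
    Coded c = Σ JPos λ X → Σ (Reachable join X) λ r → code X r ≡ c

    representative : (c : Fin (bound ^ N)) → Dec (Coded c) → Game
    representative c (yes (X , _)) = at join X
    representative c (no _)        = 𝟘

    represented : ∀ {X} r (d : Dec (Coded (code X r))) → at join X ≈ representative (code X r) d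
    represented r (yes (Y , s , same)) = _∼_ , same-code⇒∼ r s (sym same) , ∼-bisimulation
    represented {X} r (no none)        = ⊥-elim (none (X , r , refl))

    short-join : Short join
    short-join = IsWPO⇒Terminating (FiniteSubset⇒IsWPO {_≼_ = _≤_} ≤-refl support) (proj₁ ∘ short) ,
                 bound ^ N , (λ c → representative c (dec _)) , λ X r → code X r , represented r (dec _)

lemma3p3 : ExcludedMiddle (Level.suc 0ℓ) →
    (S : Set) (_≤_ : S → S → Set) → IsPartialOrder _≡_ _≤_ →
    (G : S → Game) →
    (Terminating (OrderedJoin.join _≤_ G)
      ⇔ (IsWPO _≤_ (OrderedJoin.InSupport _≤_ G) × ((i : S) → Terminating (G i))))
    × (Short (OrderedJoin.join _≤_ G)
      ⇔ (FiniteSubset (OrderedJoin.InSupport _≤_ G) × ((i : S) → Short (G i))))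
lemma3p3 em S _≤_ po G =
  mk⇔ (λ term → Terminating⇒IsWPO term , Terminating⇒Terminating-component term)
      (λ (wpo , term) → IsWPO⇒Terminating wpo term) ,
  mk⇔ (λ short → Short⇒FiniteSubset short , ShortComponent.short-component short)
      (λ (support , short) → ShortJoin.short-join short support)
  where open OrderedJoinProperties em _≤_ po G
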